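{- Let $2\le l\le n$ and let $\alpha$ be a cascading $n$-sequence which is an $l$-plateau. Then for every $i$: (1) the initial segment $\alpha[i]$ is also an $l$-plateau; (2) for every lower subinterval $I$ of $\alpha[i]$ containing both $l-1$ and $l$, the entries $l-1$ and $l$ of $I$ have the same lane number (in the lanes of $\alpha[i]$).
   Context: An $m$-lower subinterval ($1\le a\le m\le n$) is the tuple $(a,a+1,\ldots,m)$; its head is $a$ and its right endpoint is $m$. An $m$-component is a finite (possibly empty) sequence of $m$-lower subintervals ordered by nonincreasing length; a cascading $n$-sequence is the concatenation of an $n$-component, an $(n-1)$-component, $\ldots$, a $1$-component, regarded both as its list of lower subintervals $I_1,\ldots,I_P$ (left to right) and as the concatenated integer sequence. For $i\le P$, $\alpha[i]$ denotes the cascading sequence consisting of $I_1,\ldots,I_i$. Lanes of a cascading sequence: its entries are distributed into lanes $L_d(v)$ ($v\in[n]$, $d\ge1$), tuples of entries of value $v$, by processing its lower subintervals in order, all lanes initially empty; to process $I_b=(v_1,\ldots,v_s)$: let $d_1$ be the largest $d\ge1$ with $L_d(v_1)$ currently nonempty ($0$ if none) and append the entry $v_1$ of $I_b$ to $L_{d_1+1}(v_1)$; for $k=2,\ldots,s$ in order let $d_k$ be the largest $d$ with $1\le d\le d_{k-1}$ and $|L_d(v_k)|>|L_{d+1}(v_k)|$ (current lengths, $|L|$ the number of entries), or $0$ if none, and append the entry $v_k$ of $I_b$ to $L_{d_k+1}(v_k)$. A nonempty lane $L_d(v)$ is a $v$-lane with lane number $d$; an entry lying in $L_d(v)$ has lane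 number $d$. A lane ends at a right endpoint if its last entry is the right endpoint of the lower subinterval containing it. For $2\le m\le n$, a cascading sequence is an $m$-plateau if, for its lanes: (i) for every $i$ with $L_i(m)$ nonempty, $|L_i(m-1)|=|L_i(m)|-1$; (ii) no $(m-1)$-lane ends at a right endpoint; (iii) for every $k<m-1$, no $k$-lane ends at a right endpoint. -}

module Defs where

open import Data.Nat using (ℕ; zero; suc; _≤_; _<_; _∸_; _≡ᵇ_; _<ᵇ_)
open import Data.Bool using (Bool; true; false; if_then_else_; _∧_; not)
open import Data.List using (List; []; _∷_; _++_; [_]; length; null; last)
open import Data.Maybe using (Maybe; just; nothing)
open import Data.Product using (_×_; _,_; ∃-syntax)
open import Data.Sum using (_⊎_)
open import Data.List.Relation.Unary.All using (All)
open import Data.List.Relation.Unary.Linked using (Linked)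
open import Relation.Binary.PropositionalEquality using (_≡_; _≢_)
open import Relation.Nullary using (¬_)

-- A lower subinterval (a, a+1, ..., m) is encoded by the pair (a , m):
-- head a, right endpoint m.
Interval : Set
Interval = ℕ × ℕ

ValidInterval : ℕ → Interval → Set
ValidInterval n (a , m) = 1 ≤ a × a ≤ m × m ≤ n

-- Order between consecutive intervals in a cascading sequence:
-- right endpoints nonincreasing; for equal right endpoints, length
-- nonincreasing (i.e. head nondecreasing).
CascStep : Interval → Interval → Set
CascStep (a , m) (a' , m') = m' < m ⊎ (m' ≡ m × a ≤ a')

Cascading : ℕ → List Interval → Set
Cascading n α = All (ValidInterval n) α × Linked CascStep α

nth : {A : Set} → List A → ℕ → Maybe A
nth []       _       = nothing
nth (x ∷ xs) zero    = just x
nth (x ∷ xs) (suc k) = nth xs k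

-- Lanes: L v d is the list of entries in lane L_d(v), in order of appending.
-- An entry of value v is identified by the 0-based index b of the lower
-- subinterval containing it (each interval has at most one entry of value v).
Lanes : Set
Lanes = ℕ → ℕ → List ℕ

emptyLanes : Lanes
emptyLanes _ _ = []

appendLane : Lanes → ℕ → ℕ → ℕ → Lanes
appendLane L v d b v' d' =
  if (v' ≡ᵇ v) ∧ (d' ≡ᵇ d) then L v' d' ++ [ b ] else L v' d'

findDown : (ℕ → Bool) → ℕ → ℕ
findDown p zero    = 0
findDown p (suc d) = if p (suc d) then suc d else findDown p d

-- process the entries v, v+1, ... (c of them) of interval b, given d_{k-1} = dp
processRest : Lanes → ℕ → ℕ → ℕ → ℕ → Lanes
processRest L b v zero    dp = L
processRest L b v (suc c) dp =
  let dk = findDown (λ d → length (L v (suc d)) <ᵇ length (L v d)) dp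
  in processRest (appendLane L v (suc dk) b) b (suc v) c dk

-- process interval I_b = (a,...,m); B bounds all lane numbers in use
processInterval : ℕ → Lanes → ℕ → Interval → Lanes
processInterval B L b (a , m) =
  let d1 = findDown (λ d → not (null (L a d))) B
  in processRest (appendLane L a (suc d1) b) b (suc a) (m ∸ a) d1

lanesFrom : ℕ → ℕ → Lanes → List Interval → Lanes
lanesFrom B b L []       = L
lanesFrom B b L (I ∷ Is) = lanesFrom B (suc b) (processInterval B L b I) Is

-- The lanes of a cascading sequence.  Before processing I_b (0-based b) every
-- nonempty lane has number ≤ b < length α, so bound B = length α suffices.
lanes : List Interval → Lanes
lanes α = lanesFrom (length α) 0 emptyLanes α

EndsAtRight : List Interval → ℕ → ℕ → Set
EndsAtRight α v d =
  ∃[ b ] ∃[ a ] (last (lanes α v d) ≡ just b × nth α b ≡ just (a , v))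

Plateau : ℕ → List Interval → Set
Plateau m α =
    (∀ d → 1 ≤ d → lanes α m d ≢ [] →
       length (lanes α (m ∸ 1) d) ≡ length (lanes α m d) ∸ 1)
  × (∀ d → 1 ≤ d → ¬ EndsAtRight α (m ∸ 1) d)
  × (∀ k → 1 ≤ k → k < m ∸ 1 → ∀ d → 1 ≤ d → ¬ EndsAtRight α k d)

-- Write w = l - 1 and let x d, y d be the lengths of the lanes L_d(w), L_d(l) while α is processed
-- interval by interval.  The last interval has the smallest right endpoint m and its entry m ends a lane
-- of α, so conditions (ii) and (iii) force m ≥ l: every interval of α reaches l.  Hence (ii) and (iii)
-- hold vacuously in every prefix, and each interval either contains both w and l, or starts at l, or
-- starts above l.  Each kind of step preserves x d ≤ y d ≤ x d + 1 and the antitonicity of x on d ≥ 1,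
-- and none destroys a tie x d = y d ≥ 1.  Condition (i) for α says that there is no tie at the end,
-- hence none in any prefix, which is (i) for the prefix; and without a tie the entry l of an interval
-- descends exactly to the lane of its entry w.
module Submission where

open import Defs
open import Data.Nat using (ℕ; zero; suc; _≤_; _<_; _∸_; _+_; z≤n; s≤s; _≡ᵇ_; _<ᵇ_; _≟_; _<?_)
open import Data.Nat.Properties
open import Data.Bool using (Bool; T; true; false; not; if_then_else_; _∧_)
open import Data.List using (List; []; _∷_; _++_; [_]; length; take; null; last)
open import Data.List.Properties using (length-++; length-take; take-all)
open import Data.List.Membership.Propositional using (_∈_)
open import Data.List.Membership.Propositional.Properties using (∈-++⁺ˡ; ∈-++⁺ʳ)
open import Data.List.Relation.Unary.All using (All; _∷_)
open import Data.List.Relation.Unary.Any using (here)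
open import Data.List.Relation.Unary.Linked using (Linked; _∷_)
open import Data.Maybe using (just)
open import Data.Product using (_×_; _,_; ∃-syntax; proj₁; proj₂)
open import Data.Sum using (_⊎_; inj₁; inj₂)
open import Data.Empty using (⊥-elim)
open import Data.Unit using (tt)
open import Relation.Binary.Definitions using (tri<; tri≈; tri>)
open import Relation.Binary.PropositionalEquality hiding ([_])
open import Relation.Nullary using (¬_; yes; no)

≡ᵇ-refl : ∀ n → (n ≡ᵇ n) ≡ true
≡ᵇ-refl zero    = refl
≡ᵇ-refl (suc n) = ≡ᵇ-refl n

≢⇒≡ᵇ≡false : ∀ m n → m ≢ n → (m ≡ᵇ n) ≡ false
≢⇒≡ᵇ≡false m n m≢n with m ≡ᵇ n in eq
... | true  = ⊥-elim (m≢n (≡ᵇ⇒≡ m n (subst T (sym eq) tt)))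
... | false = refl

<ᵇ≡false⇒≥ : ∀ m n → (m <ᵇ n) ≡ false → n ≤ m
<ᵇ≡false⇒≥ m n eq = ≮⇒≥ λ m<n → subst T eq (<⇒<ᵇ m<n)

length-snoc : ∀ {A : Set} (xs : List A) b → length (xs ++ [ b ]) ≡ suc (length xs)
length-snoc xs b = trans (length-++ xs) (+-comm (length xs) 1)

last-snoc : ∀ {A : Set} (xs : List A) b → last (xs ++ [ b ]) ≡ just b
last-snoc []           b = refl
last-snoc (x ∷ [])     b = refl
last-snoc (x ∷ y ∷ xs) b = last-snoc (y ∷ xs) b

nonNull≡false⇒≡[] : ∀ {A : Set} {xs : List A} → not (null xs) ≡ false → xs ≡ []
nonNull≡false⇒≡[] {xs = []} _ = refl

nonNull⇒length>0 : ∀ {A : Set} {xs : List A} → not (null xs) ≡ true → 0 < length xs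
nonNull⇒length>0 {xs = _ ∷ _} _ = s≤s z≤n

≢[]⇒length>0 : ∀ {A : Set} {xs : List A} → xs ≢ [] → 0 < length xs
≢[]⇒length>0 {xs = []}    xs≢[] = ⊥-elim (xs≢[] refl)
≢[]⇒length>0 {xs = _ ∷ _} _     = s≤s z≤n

appendLane-here : ∀ L v d b → appendLane L v d b v d ≡ L v d ++ [ b ]
appendLane-here L v d b rewrite ≡ᵇ-refl v | ≡ᵇ-refl d = refl

appendLane-otherValue : ∀ L v g b v' d → v' ≢ v → appendLane L v g b v' d ≡ L v' d
appendLane-otherValue L v g b v' d v'≢v rewrite ≢⇒≡ᵇ≡false v' v v'≢v = refl

appendLane-otherLane : ∀ L v g b v' d → d ≢ g → appendLane L v g b v' d ≡ L v' d
appendLane-otherLane L v g b v' d d≢g rewrite ≢⇒≡ᵇ≡false d g d≢g with v' ≡ᵇ v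
... | true  = refl
... | false = refl

appendLane-cases : ∀ L v g b v' d → (v' ≡ v × d ≡ g) ⊎ appendLane L v g b v' d ≡ L v' d
appendLane-cases L v g b v' d with v' ≟ v | d ≟ g
... | yes v'≡v | yes d≡g = inj₁ (v'≡v , d≡g)
... | no  v'≢v | _        = inj₂ (appendLane-otherValue L v g b v' d v'≢v)
... | yes _    | no  d≢g  = inj₂ (appendLane-otherLane L v g b v' d d≢g)

appendLane-cong : ∀ L L' u g b v d → L v d ≡ L' v d → appendLane L u g b v d ≡ appendLane L' u g b v d
appendLane-cong L L' u g b v d eq = cong (λ lane → if (v ≡ᵇ u) ∧ (d ≡ᵇ g) then lane ++ [ b ] else lane) eq

∈-appendLane⁺ : ∀ {x} L v g b v' d → x ∈ L v' d → x ∈ appendLane L v g b v' d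
∈-appendLane⁺ L v g b v' d x∈ with appendLane-cases L v g b v' d
... | inj₁ (refl , refl) rewrite appendLane-here L v d b = ∈-++⁺ˡ x∈
... | inj₂ eq rewrite eq = x∈

∈-appendLane-here : ∀ L v g b → b ∈ appendLane L v g b v g
∈-appendLane-here L v g b = subst (b ∈_) (sym (appendLane-here L v g b)) (∈-++⁺ʳ (L v g) (here refl))

BumpedAt : ℕ → (ℕ → ℕ) → (ℕ → ℕ) → Set
BumpedAt g x x' = x' g ≡ suc (x g) × (∀ d → d ≢ g → x' d ≡ x d)

BumpedAt-cong : ∀ {g x x' x''} → (∀ d → x'' d ≡ x' d) → BumpedAt g x x' → BumpedAt g x x''
BumpedAt-cong {g} eq (at , off) = trans (eq g) at , λ d d≢g → trans (eq d) (off d d≢g)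

appendLane-bumps : ∀ L v g b → BumpedAt g (λ d → length (L v d)) (λ d → length (appendLane L v g b v d))
appendLane-bumps L v g b =
  trans (cong length (appendLane-here L v g b)) (length-snoc (L v g) b) ,
  λ d d≢g → cong length (appendLane-otherLane L v g b v d d≢g)

findDown-≤ : ∀ p n → findDown p n ≤ n
findDown-≤ p zero    = z≤n
findDown-≤ p (suc n) with p (suc n)
... | true  = ≤-refl
... | false = m≤n⇒m≤1+n (findDown-≤ p n)

findDown-found : ∀ p n → findDown p n ≡ 0 ⊎ p (findDown p n) ≡ true
findDown-found p zero    = inj₁ refl
findDown-found p (suc n) with p (suc n) in eq
... | true  = inj₂ eq
... | false = findDown-found p n

findDown-maximal : ∀ p n j → findDown p n < j → j ≤ n → p j ≡ false
findDown-maximal p zero    j found<j j≤0 = ⊥-elim (<⇒≱ found<j (≤-trans j≤0 z≤n))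
findDown-maximal p (suc n) j found<j j≤n with p (suc n) in eq
... | true  = ⊥-elim (<⇒≱ found<j j≤n)
... | false with m≤n⇒m<n∨m≡n j≤n
...   | inj₂ refl = eq
...   | inj₁ j<n  = findDown-maximal p n j found<j (≤-pred j<n)

findDown-cong : ∀ p q n → (∀ d → p d ≡ q d) → findDown p n ≡ findDown q n
findDown-cong p q zero    p≗q = refl
findDown-cong p q (suc n) p≗q rewrite p≗q (suc n) | findDown-cong p q n p≗q = refl

findDown-stable : ∀ p n N → n ≤ N → (∀ j → n < j → j ≤ N → p j ≡ false) → findDown p N ≡ findDown p n
findDown-stable p n zero    z≤n      _     = refl
findDown-stable p n (suc N) n≤N+1 false↑ with m≤n⇒m<n∨m≡n n≤N+1
... | inj₂ refl = refl
... | inj₁ n<N+1 rewrite false↑ (suc N) n<N+1 ≤-refl =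
  findDown-stable p n N (≤-pred n<N+1) (λ j n<j j≤N → false↑ j n<j (m≤n⇒m≤1+n j≤N))

topLane : ℕ → Lanes → ℕ → ℕ
topLane B L a = findDown (λ d → not (null (L a d))) B

EmptyAbove : ℕ → Lanes → Set
EmptyAbove k L = ∀ v d → k < d → L v d ≡ []

EmptyAbove-suc : ∀ {k L} → EmptyAbove k L → EmptyAbove (suc k) L
EmptyAbove-suc {k} empty v d k+1<d = empty v d (<-trans (n<1+n k) k+1<d)

EmptyAbove-appendLane : ∀ k L v g b → EmptyAbove k L → g ≤ k → EmptyAbove k (appendLane L v g b)
EmptyAbove-appendLane k L v g b empty g≤k v' d k<d with appendLane-cases L v g b v' d
... | inj₁ (_ , refl) = ⊥-elim (<⇒≱ k<d g≤k)
... | inj₂ eq         = trans eq (empty v' d k<d)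

topLane-≤ : ∀ B L a b → EmptyAbove b L → topLane B L a ≤ b
topLane-≤ B L a b empty with findDown-found (λ d → not (null (L a d))) B
... | inj₁ top≡0  rewrite top≡0 = z≤n
... | inj₂ nonNull = ≮⇒≥ λ b<top → emptyNonNull (empty a _ b<top) nonNull
  where
    emptyNonNull : ∀ {xs : List ℕ} → xs ≡ [] → not (null xs) ≢ true
    emptyNonNull refl ()

topLane-successorEmpty : ∀ B L b a → EmptyAbove b L → b < B → L a (suc (topLane B L a)) ≡ []
topLane-successorEmpty B L b a empty b<B with b <? suc (topLane B L a)
... | yes b<top+1 = empty a _ b<top+1
... | no  b≮top+1 = nonNull≡false⇒≡[] (findDown-maximal _ B (suc (topLane B L a)) (n<1+n _)
                                     (≤-trans (≮⇒≥ b≮top+1) (<⇒≤ b<B)))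

DropAt : (ℕ → ℕ) → ℕ → Set
DropAt x d = d ≡ 0 ⊎ x (suc d) < x d

topLane-drop : ∀ B L b a → EmptyAbove b L → b < B → DropAt (λ d → length (L a d)) (topLane B L a)
topLane-drop B L b a empty b<B with findDown-found (λ d → not (null (L a d))) B
... | inj₁ top≡0   = inj₁ top≡0
... | inj₂ nonNull rewrite topLane-successorEmpty B L b a empty b<B = inj₂ (nonNull⇒length>0 nonNull)

processRest-below : ∀ L b v c dp u d → u < v → processRest L b v c dp u d ≡ L u d
processRest-below L b v zero    dp u d u<v = refl
processRest-below L b v (suc c) dp u d u<v =
  trans (processRest-below _ b (suc v) c _ u d (m≤n⇒m≤1+n u<v))
        (appendLane-otherValue L v _ b u d (<⇒≢ u<v))

EmptyAbove-processRest : ∀ k L b v c dp → EmptyAbove k L → dp < k → EmptyAbove k (processRest L b v c dp)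
EmptyAbove-processRest k L b v zero    dp empty dp<k = empty
EmptyAbove-processRest k L b v (suc c) dp empty dp<k =
  EmptyAbove-processRest k _ b (suc v) c _ (EmptyAbove-appendLane k L v _ b empty next<k) next<k
  where next<k = ≤-trans (s≤s (findDown-≤ _ dp)) dp<k

EmptyAbove-processInterval : ∀ B L b a m → EmptyAbove b L → EmptyAbove (suc b) (processInterval B L b (a , m))
EmptyAbove-processInterval B L b a m empty =
  EmptyAbove-processRest (suc b) _ b (suc a) (m ∸ a) _
    (EmptyAbove-appendLane (suc b) L a _ b (EmptyAbove-suc empty) top<b+1) top<b+1
  where top<b+1 = s≤s (topLane-≤ B L a b empty)

∈-processRest⁺ : ∀ {x} L b v c dp v' d → x ∈ L v' d → x ∈ processRest L b v c dp v' d
∈-processRest⁺ L b v zero    dp v' d x∈ = x∈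
∈-processRest⁺ L b v (suc c) dp v' d x∈ = ∈-processRest⁺ _ b (suc v) c _ v' d (∈-appendLane⁺ L v _ b v' d x∈)

∈-processInterval⁺ : ∀ {x} B L b a m v' d → x ∈ L v' d → x ∈ processInterval B L b (a , m) v' d
∈-processInterval⁺ B L b a m v' d x∈ = ∈-processRest⁺ _ b (suc a) (m ∸ a) _ v' d (∈-appendLane⁺ L a _ b v' d x∈)

processRest-reach : ∀ L b v c dp u → v ≤ u → u < v + c →
  ∃[ L' ] ∃[ dp' ] ∃[ c' ] (processRest L b v c dp ≡ processRest L' b u (suc c') dp'
     × v + c ≡ u + suc c' × (∀ u' d → u ≤ u' → L' u' d ≡ L u' d))
processRest-reach L b v zero    dp u v≤u u<v+0 = ⊥-elim (<⇒≱ u<v+0 (≤-trans (≤-reflexive (+-identityʳ v)) v≤u))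
processRest-reach L b v (suc c) dp u v≤u u<v+c+1 with m≤n⇒m<n∨m≡n v≤u
... | inj₂ refl = L , dp , c , refl , refl , λ _ _ _ → refl
... | inj₁ v<u with processRest-reach _ b (suc v) c _ u v<u (≤-trans u<v+c+1 (≤-reflexive (+-suc v c)))
...   | L' , dp' , c' , eq , count , agree =
  L' , dp' , c' , eq , trans (+-suc v c) count ,
  λ u' d u≤u' → trans (agree u' d u≤u')
                  (appendLane-otherValue L v _ b u' d λ u'≡v → <⇒≱ v<u (≤-trans u≤u' (≤-reflexive u'≡v)))

processInterval-rightEndpoint : ∀ B L b a m → a ≤ m → ∃[ d ] (last (processInterval B L b (a , m) m (suc d)) ≡ just b)
processInterval-rightEndpoint B L b a m a≤m with m≤n⇒m<n∨m≡n a≤m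
... | inj₂ refl =
  top , trans (cong (λ c → last (processRest L₀ b (suc a) c top a (suc top))) (n∸n≡0 a))
              (trans (cong last (appendLane-here L a (suc top) b)) (last-snoc (L a (suc top)) b))
  where
    top = topLane B L a
    L₀  = appendLane L a (suc top) b
... | inj₁ a<m with processRest-reach (appendLane L a (suc (topLane B L a)) b) b (suc a) (m ∸ a) (topLane B L a) m a<m
                      (≤-reflexive (sym (cong suc (m+[n∸m]≡n a≤m))))
...   | L' , dp' , suc c , _ , count , _ = ⊥-elim (<-irrefl refl (≤-<-trans (≤-reflexive m+c+1≡m) (m<m+n m (s≤s z≤n))))
  where
    m+c+1≡m : m + suc c ≡ m
    m+c+1≡m = suc-injective (trans (sym (+-suc m (suc c))) (trans (sym count) (cong suc (m+[n∸m]≡n a≤m))))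
...   | L' , dp' , zero , eq , _ , _ =
  dk , trans (cong (λ L'' → last (L'' m (suc dk))) eq)
             (trans (cong last (appendLane-here L' m (suc dk) b)) (last-snoc (L' m (suc dk)) b))
  where dk = findDown (λ d → length (L' m (suc d)) <ᵇ length (L' m d)) dp'

Interlaced : (ℕ → ℕ) → (ℕ → ℕ) → Set
Interlaced x y = ∀ d → x d ≤ y d × y d ≤ suc (x d)

Antitone⁺ : (ℕ → ℕ) → Set
Antitone⁺ x = ∀ d → x (suc (suc d)) ≤ x (suc d)

-- For interlaced counts this is exactly the failure of plateau condition (i).
Tied : (ℕ → ℕ) → (ℕ → ℕ) → Set
Tied x y = ∃[ d ] (1 ≤ d × 1 ≤ y d × x d ≡ y d)

dropsAt : (ℕ → ℕ) → ℕ → Bool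
dropsAt y d = y (suc d) <ᵇ y d

Antitone⁺-≤ : ∀ {x} → Antitone⁺ x → ∀ lo hi → 1 ≤ lo → lo ≤ hi → x hi ≤ x lo
Antitone⁺-≤ anti lo zero          1≤lo lo≤0    = ⊥-elim (<⇒≱ 1≤lo lo≤0)
Antitone⁺-≤ anti lo (suc hi)      1≤lo lo≤hi+1 with m≤n⇒m<n∨m≡n lo≤hi+1
... | inj₂ refl = ≤-refl
Antitone⁺-≤ anti lo (suc zero)    1≤lo _ | inj₁ lo<1   = ⊥-elim (<⇒≱ 1≤lo (≤-pred lo<1))
Antitone⁺-≤ {x} anti lo (suc (suc h)) 1≤lo _ | inj₁ lo<h+2 =
  ≤-trans (anti h) (Antitone⁺-≤ {x} anti lo (suc h) 1≤lo (≤-pred lo<h+2))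

findDown-dropsAt-≤ : ∀ (y : ℕ → ℕ) k → y (suc (findDown (dropsAt y) k)) ≤ y (suc k)
findDown-dropsAt-≤ y zero    = ≤-refl
findDown-dropsAt-≤ y (suc k) with dropsAt y (suc k) in eq
... | true  = ≤-refl
... | false = ≤-trans (findDown-dropsAt-≤ y k) (<ᵇ≡false⇒≥ _ _ eq)

-- If y does not drop where x does, interlacing forces a tie there; below it y rises while x falls.
findDown-dropsAt : ∀ x y de → Interlaced x y → Antitone⁺ x → DropAt x de →
  findDown (dropsAt y) de ≡ de ⊎
  (findDown (dropsAt y) de < de × Tied x y × y (suc de) ≡ suc (x (suc de))
    × x (suc (findDown (dropsAt y) de)) ≡ y (suc (findDown (dropsAt y) de)))
findDown-dropsAt x y zero    inter anti drop          = inj₁ refl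
findDown-dropsAt x y (suc k) inter anti (inj₁ ())
findDown-dropsAt x y (suc k) inter anti (inj₂ x-drop) with dropsAt y (suc k) in eq
... | true  = inj₁ refl
... | false = inj₂ (s≤s (findDown-≤ (dropsAt y) k) , (suc k , s≤s z≤n , 1≤y , tie) , gap , tie-below)
  where
    y-rise : y (suc k) ≤ y (suc (suc k))
    y-rise = <ᵇ≡false⇒≥ _ _ eq
    tie : x (suc k) ≡ y (suc k)
    tie = ≤-antisym (proj₁ (inter (suc k))) (≤-trans y-rise (≤-trans (proj₂ (inter (suc (suc k)))) x-drop))
    gap : y (suc (suc k)) ≡ suc (x (suc (suc k)))
    gap = ≤-antisym (proj₂ (inter (suc (suc k)))) (≤-trans x-drop (≤-trans (proj₁ (inter (suc k))) y-rise))
    1≤y : 1 ≤ y (suc k)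
    1≤y = ≤-trans (s≤s z≤n) (≤-trans x-drop (proj₁ (inter (suc k))))
    f = findDown (dropsAt y) k
    tie-below : x (suc f) ≡ y (suc f)
    tie-below = ≤-antisym (proj₁ (inter (suc f)))
      (≤-trans (findDown-dropsAt-≤ y k)
        (≤-trans (≤-reflexive (sym tie)) (Antitone⁺-≤ {x} anti (suc f) (suc k) (s≤s z≤n) (s≤s (findDown-≤ (dropsAt y) k)))))

Interlaced-bump : ∀ {g x y x' y'} → Interlaced x y → BumpedAt g x x' → BumpedAt g y y' → Interlaced x' y'
Interlaced-bump {g} inter (x'g , x'≗x) (y'g , y'≗y) d with d ≟ g
... | yes refl rewrite x'g | y'g      = s≤s (proj₁ (inter d)) , s≤s (proj₂ (inter d))
... | no  d≢g  rewrite x'≗x d d≢g | y'≗y d d≢g = inter d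

Tied-bump : ∀ {g x y x' y'} → BumpedAt g x x' → BumpedAt g y y' → Tied x y → Tied x' y'
Tied-bump {g} (x'g , x'≗x) (y'g , y'≗y) (d , 1≤d , 1≤yd , xd≡yd) with d ≟ g
... | yes refl = d , 1≤d , subst (1 ≤_) (sym y'g) (s≤s z≤n) , trans x'g (trans (cong suc xd≡yd) (sym y'g))
... | no  d≢g  = d , 1≤d , subst (1 ≤_) (sym (y'≗y d d≢g)) 1≤yd , trans (x'≗x d d≢g) (trans xd≡yd (sym (y'≗y d d≢g)))

Interlaced-bumpApart : ∀ {g h x y x' y'} → Interlaced x y → BumpedAt g x x' → BumpedAt h y y' → g ≢ h →
  y g ≡ suc (x g) → x h ≡ y h → Interlaced x' y'
Interlaced-bumpApart {g} {h} inter (x'g , x'≗x) (y'h , y'≗y) g≢h gap tie d with d ≟ g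
... | yes refl rewrite x'g | y'≗y d g≢h | gap = ≤-refl , n≤1+n _
... | no  d≢g  with d ≟ h
...   | yes refl rewrite x'≗x d d≢g | y'h | tie = n≤1+n _ , ≤-refl
...   | no  d≢h  rewrite x'≗x d d≢g | y'≗y d d≢h = inter d

Tied-bumpApart : ∀ {g h x y x' y'} → BumpedAt g x x' → BumpedAt h y y' → g ≢ h → 1 ≤ g →
  y g ≡ suc (x g) → Tied x' y'
Tied-bumpApart {g} (x'g , _) (_ , y'≗y) g≢h 1≤g gap = g , 1≤g , subst (1 ≤_) (sym y'g) (s≤s z≤n) , trans x'g (sym y'g)
  where
    y'g = trans (y'≗y g g≢h) gap

Antitone⁺-bump : ∀ {x x' de} → Antitone⁺ x → DropAt x de → BumpedAt (suc de) x x' → Antitone⁺ x'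
Antitone⁺-bump {x} {x'} {de} anti drop (x'g , x'≗x) d with suc (suc d) ≟ suc de | suc d ≟ suc de
... | yes d+2≡g | _ with suc-injective d+2≡g
...   | refl with drop
...     | inj₁ ()
...     | inj₂ x-drop rewrite x'g | x'≗x (suc d) (λ d+1≡d+2 → <-irrefl (suc-injective d+1≡d+2) (n<1+n d)) = x-drop
Antitone⁺-bump anti drop (x'g , x'≗x) d | no d+2≢g | yes refl rewrite x'≗x (suc (suc d)) d+2≢g | x'g = m≤n⇒m≤1+n (anti d)
Antitone⁺-bump anti drop (x'g , x'≗x) d | no d+2≢g | no d+1≢g rewrite x'≗x (suc (suc d)) d+2≢g | x'≗x (suc d) d+1≢g = anti d

bumpBoth : ∀ {x y x' y'} de → Interlaced x y → Antitone⁺ x → DropAt x de →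
  BumpedAt (suc de) x x' → BumpedAt (suc (findDown (dropsAt y) de)) y y' →
  Interlaced x' y' × Antitone⁺ x' × (Tied x y → Tied x' y') × (¬ Tied x y → findDown (dropsAt y) de ≡ de)
bumpBoth {y = y} {y' = y'} de inter anti drop bx by with findDown-dropsAt _ _ de inter anti drop
... | inj₁ f≡de =
  Interlaced-bump inter bx by' , Antitone⁺-bump anti drop bx , Tied-bump bx by' , λ _ → f≡de
  where
    by' = subst (λ f → BumpedAt (suc f) y y') f≡de by
... | inj₂ (f<de , tie , gap , tie-below) =
  Interlaced-bumpApart inter bx by g≢h gap tie-below , Antitone⁺-bump anti drop bx ,
  (λ _ → Tied-bumpApart bx by g≢h (s≤s z≤n) gap) , λ ¬tie → ⊥-elim (¬tie tie)
  where
    g≢h : suc de ≢ suc (findDown (dropsAt y) de)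
    g≢h g≡h = <-irrefl (sym (suc-injective g≡h)) f<de

Interlaced-bumpHigh : ∀ {g x y y'} → Interlaced x y → BumpedAt g y y' → y g ≡ 0 → Interlaced x y'
Interlaced-bumpHigh {g} {x} inter (y'g , y'≗y) yg≡0 d with d ≟ g
... | yes refl rewrite y'g | yg≡0 | n≤0⇒n≡0 (subst (x d ≤_) yg≡0 (proj₁ (inter d))) = z≤n , s≤s z≤n
... | no  d≢g  rewrite y'≗y d d≢g = inter d

Tied-bumpHigh : ∀ {g x y y'} → BumpedAt g y y' → y g ≡ 0 → Tied x y → Tied x y'
Tied-bumpHigh {g} (_ , y'≗y) yg≡0 (d , 1≤d , 1≤yd , xd≡yd) =
  d , 1≤d , subst (1 ≤_) (sym (y'≗y d d≢g)) 1≤yd , trans xd≡yd (sym (y'≗y d d≢g))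
  where
    d≢g : d ≢ g
    d≢g refl = <-irrefl (sym yg≡0) 1≤yd

Interlaced-cong : ∀ {x y x' y'} → (∀ d → x' d ≡ x d) → (∀ d → y' d ≡ y d) → Interlaced x y → Interlaced x' y'
Interlaced-cong {x} {y} x'≗x y'≗y inter d =
  subst₂ (λ p q → p ≤ q × q ≤ suc p) (sym (x'≗x d)) (sym (y'≗y d)) (inter d)

Antitone⁺-cong : ∀ {x x'} → (∀ d → x' d ≡ x d) → Antitone⁺ x → Antitone⁺ x'
Antitone⁺-cong x'≗x anti d = subst₂ _≤_ (sym (x'≗x (suc (suc d)))) (sym (x'≗x (suc d))) (anti d)

Tied-cong : ∀ {x y x' y'} → (∀ d → x' d ≡ x d) → (∀ d → y' d ≡ y d) → Tied x y → Tied x' y'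
Tied-cong x'≗x y'≗y (d , 1≤d , 1≤yd , xd≡yd) =
  d , 1≤d , subst (1 ≤_) (sym (y'≗y d)) 1≤yd , trans (x'≗x d) (trans xd≡yd (sym (y'≗y d)))

module TwoValues (w : ℕ) where

  xOf yOf : Lanes → ℕ → ℕ
  xOf L d = length (L w d)
  yOf L d = length (L (suc w) d)

  Balanced : Lanes → Set
  Balanced L = Interlaced (xOf L) (yOf L) × Antitone⁺ (xOf L)

  TiedLanes : Lanes → Set
  TiedLanes L = Tied (xOf L) (yOf L)

  SharedLane : ℕ → Lanes → Set
  SharedLane b L = ∃[ d ] (b ∈ L w d × b ∈ L (suc w) d)

  PairedEffect : ℕ → Lanes → Lanes → Set
  PairedEffect b L L' = ∃[ de ] (DropAt (xOf L) de
    × (∀ d → L' w d ≡ appendLane L w (suc de) b w d)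
    × (∀ d → L' (suc w) d ≡ appendLane L (suc w) (suc (findDown (dropsAt (yOf L)) de)) b (suc w) d))

  HighEffect : ℕ → Lanes → Lanes → Set
  HighEffect b L L' = ∃[ g ] (L (suc w) g ≡ []
    × (∀ d → L' w d ≡ L w d)
    × (∀ d → L' (suc w) d ≡ appendLane L (suc w) g b (suc w) d))

  pairedEffect-fromLow : ∀ L L' b c de → (∀ u d → w ≤ u → L' u d ≡ L u d) → DropAt (xOf L) de →
    PairedEffect b L (processRest (appendLane L' w (suc de) b) b (suc w) (suc c) de)
  pairedEffect-fromLow L L' b c de agree drop = de , drop , low , high
    where
      L₁ = appendLane L' w (suc de) b
      dl = findDown (dropsAt (yOf L₁)) de
      L₂ = appendLane L₁ (suc w) (suc dl) b
      L₁≈L : ∀ d → L₁ (suc w) d ≡ L (suc w) d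
      L₁≈L d = trans (appendLane-otherValue L' w (suc de) b (suc w) d (λ ())) (agree (suc w) d (n≤1+n w))
      dl≡ : dl ≡ findDown (dropsAt (yOf L)) de
      dl≡ = findDown-cong _ _ de (λ d → cong₂ _<ᵇ_ (cong length (L₁≈L (suc d))) (cong length (L₁≈L d)))
      low : ∀ d → processRest L₂ b (suc (suc w)) c dl w d ≡ appendLane L w (suc de) b w d
      low d = trans (processRest-below L₂ b (suc (suc w)) c dl w d (m≤n⇒m≤1+n (n<1+n w)))
                (trans (appendLane-otherValue L₁ (suc w) (suc dl) b w d (λ ()))
                       (appendLane-cong L' L w (suc de) b w d (agree w d ≤-refl)))
      high : ∀ d → processRest L₂ b (suc (suc w)) c dl (suc w) d
                 ≡ appendLane L (suc w) (suc (findDown (dropsAt (yOf L)) de)) b (suc w) d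
      high d = trans (processRest-below L₂ b (suc (suc w)) c dl (suc w) d (n<1+n _))
                 (trans (appendLane-cong L₁ L (suc w) (suc dl) b (suc w) d (L₁≈L d))
                        (cong (λ f → appendLane L (suc w) (suc f) b (suc w) d) dl≡))

  pairedEffect-headLow : ∀ B L b m → EmptyAbove b L → b < B → w < m → PairedEffect b L (processInterval B L b (w , m))
  pairedEffect-headLow B L b (suc m) empty b<B (s≤s w≤m) =
    subst (λ c → PairedEffect b L (processRest (appendLane L w (suc top) b) b (suc w) c top)) (sym (+-∸-assoc 1 w≤m))
      (pairedEffect-fromLow L L b (m ∸ w) top (λ _ _ _ → refl) (topLane-drop B L b w empty b<B))
    where
      top = topLane B L w

  pairedEffect-innerLow : ∀ B L b a m → a < w → w < m → PairedEffect b L (processInterval B L b (a , m))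
  pairedEffect-innerLow B L b a m a<w w<m
    with processRest-reach (appendLane L a (suc (topLane B L a)) b) b (suc a) (m ∸ a) (topLane B L a) w a<w
           (≤-trans (m≤n⇒m≤1+n w<m) (≤-reflexive (sym (cong suc (m+[n∸m]≡n (<⇒≤ (<-trans a<w w<m)))))))
  ... | L' , dp' , zero , _ , count , _ = ⊥-elim (<-irrefl (sym m≡w) w<m)
    where
      m≡w : m ≡ w
      m≡w = suc-injective (trans (sym (cong suc (m+[n∸m]≡n (<⇒≤ (<-trans a<w w<m))))) (trans count (+-comm w 1)))
  ... | L' , dp' , suc c , eq , _ , agree = subst (PairedEffect b L) (sym eq) (pairedEffect-fromLow L L' b c dk agreeL drop)
    where
      agreeL : ∀ u d → w ≤ u → L' u d ≡ L u d
      agreeL u d w≤u = trans (agree u d w≤u)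
        (appendLane-otherValue L a _ b u d (λ u≡a → <⇒≱ a<w (≤-trans w≤u (≤-reflexive u≡a))))
      dk = findDown (dropsAt (xOf L')) dp'
      drop : DropAt (xOf L) dk
      drop with findDown-found (dropsAt (xOf L')) dp'
      ... | inj₁ dk≡0  = inj₁ dk≡0
      ... | inj₂ drops = inj₂ (subst₂ _<_ (cong length (agreeL w (suc dk) ≤-refl)) (cong length (agreeL w dk ≤-refl))
                                 (<ᵇ⇒< _ _ (subst T (sym drops) tt)))

  highEffect : ∀ B L b m → EmptyAbove b L → b < B → HighEffect b L (processInterval B L b (suc w , m))
  highEffect B L b m empty b<B = suc top , topLane-successorEmpty B L b (suc w) empty b<B , low , high
    where
      top = topLane B L (suc w)
      L₀  = appendLane L (suc w) (suc top) b
      low : ∀ d → processInterval B L b (suc w , m) w d ≡ L w d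
      low d = trans (processRest-below L₀ b (suc (suc w)) (m ∸ suc w) top w d (m≤n⇒m≤1+n (n<1+n w)))
                    (appendLane-otherValue L (suc w) (suc top) b w d (λ ()))
      high : ∀ d → processInterval B L b (suc w , m) (suc w) d ≡ appendLane L (suc w) (suc top) b (suc w) d
      high d = processRest-below L₀ b (suc (suc w)) (m ∸ suc w) top (suc w) d (n<1+n _)

  processInterval-untouched : ∀ B L b a m → suc w < a → ∀ d →
    processInterval B L b (a , m) w d ≡ L w d × processInterval B L b (a , m) (suc w) d ≡ L (suc w) d
  processInterval-untouched B L b a m w+1<a d =
    trans (processRest-below L₀ b (suc a) (m ∸ a) _ w d (m≤n⇒m≤1+n (<-trans (n<1+n w) w+1<a)))
          (appendLane-otherValue L a _ b w d (λ w≡a → <-irrefl w≡a (<-trans (n<1+n w) w+1<a))) ,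
    trans (processRest-below L₀ b (suc a) (m ∸ a) _ (suc w) d (m≤n⇒m≤1+n w+1<a))
          (appendLane-otherValue L a _ b (suc w) d (λ w+1≡a → <-irrefl w+1≡a w+1<a))
    where
      L₀ = appendLane L a (suc (topLane B L a)) b

  pairedStep : ∀ b L L' → PairedEffect b L L' → Balanced L →
    Balanced L' × (TiedLanes L → TiedLanes L') × (¬ TiedLanes L → SharedLane b L')
  pairedStep b L L' (de , drop , low , high) (inter , anti)
    with bumpBoth de inter anti drop
           (BumpedAt-cong (λ d → cong length (low d)) (appendLane-bumps L w (suc de) b))
           (BumpedAt-cong (λ d → cong length (high d)) (appendLane-bumps L (suc w) _ b))
  ... | inter' , anti' , tied' , sameLane =
    (inter' , anti') , tied' , λ ¬tied → suc de ,
      subst (b ∈_) (sym (low (suc de))) (∈-appendLane-here L w (suc de) b) ,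
      subst (b ∈_) (sym (trans (high (suc de)) (cong (λ f → appendLane L (suc w) (suc f) b (suc w) (suc de)) (sameLane ¬tied))))
        (∈-appendLane-here L (suc w) (suc de) b)

  highStep : ∀ b L L' → HighEffect b L L' → Balanced L → Balanced L' × (TiedLanes L → TiedLanes L')
  highStep b L L' (g , emptyLane , low , high) (inter , anti) =
    (Interlaced-cong x'≗x (λ _ → refl) (Interlaced-bumpHigh inter bumped (cong length emptyLane)) , Antitone⁺-cong x'≗x anti) ,
    λ tied → Tied-cong x'≗x (λ _ → refl) (Tied-bumpHigh bumped (cong length emptyLane) tied)
    where
      x'≗x = λ d → cong length (low d)
      bumped = BumpedAt-cong (λ d → cong length (high d)) (appendLane-bumps L (suc w) g b)

  processInterval-balanced : ∀ B L b a m → EmptyAbove b L → b < B → w < m → Balanced L →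
    Balanced (processInterval B L b (a , m))
    × (TiedLanes L → TiedLanes (processInterval B L b (a , m)))
    × (a ≤ w → ¬ TiedLanes L → SharedLane b (processInterval B L b (a , m)))
  processInterval-balanced B L b a m empty b<B w<m bal with <-cmp a w
  ... | tri< a<w _ _ with pairedStep b L (processInterval B L b (a , m)) (pairedEffect-innerLow B L b a m a<w w<m) bal
  ...   | bal' , tied' , shared = bal' , tied' , λ _ → shared
  processInterval-balanced B L b a m empty b<B w<m bal | tri≈ _ refl _
    with pairedStep b L (processInterval B L b (w , m)) (pairedEffect-headLow B L b m empty b<B w<m) bal
  ...   | bal' , tied' , shared = bal' , tied' , λ _ → shared
  processInterval-balanced B L b a m empty b<B w<m bal | tri> _ _ w<a with m≤n⇒m<n∨m≡n w<a
  ... | inj₂ refl with highStep b L (processInterval B L b (suc w , m)) (highEffect B L b m empty b<B) bal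
  ...   | bal' , tied' = bal' , tied' , λ a≤w _ → ⊥-elim (<⇒≱ w<a a≤w)
  processInterval-balanced B L b a m empty b<B w<m (inter , anti) | tri> _ _ w<a | inj₁ w+1<a =
    (Interlaced-cong x'≗x y'≗y inter , Antitone⁺-cong x'≗x anti) , Tied-cong x'≗x y'≗y ,
    λ a≤w _ → ⊥-elim (<⇒≱ w<a a≤w)
    where
      x'≗x = λ d → cong length (proj₁ (processInterval-untouched B L b a m w+1<a d))
      y'≗y = λ d → cong length (proj₂ (processInterval-untouched B L b a m w+1<a d))

  PlateauLanes : Lanes → Set
  PlateauLanes L = ∀ d → 1 ≤ d → L (suc w) d ≢ [] → length (L w d) ≡ length (L (suc w) d) ∸ 1

  plateauLanes⇒untied : ∀ L → PlateauLanes L → ¬ TiedLanes L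
  plateauLanes⇒untied L plateau (d , 1≤d , 1≤yd , xd≡yd) =
    y≢y∸1 1≤yd (trans (sym xd≡yd) (plateau d 1≤d nonEmpty))
    where
      nonEmpty : L (suc w) d ≢ []
      nonEmpty empty = <⇒≱ 1≤yd (≤-reflexive (cong length empty))
      y≢y∸1 : ∀ {y} → 1 ≤ y → y ≢ y ∸ 1
      y≢y∸1 {suc y} _ y+1≡y = <-irrefl (sym y+1≡y) (n<1+n y)

  untied⇒plateauLanes : ∀ L → Interlaced (xOf L) (yOf L) → ¬ TiedLanes L → PlateauLanes L
  untied⇒plateauLanes L inter ¬tied d 1≤d nonEmpty with m≤n⇒m<n∨m≡n (proj₁ (inter d))
  ... | inj₂ xd≡yd = ⊥-elim (¬tied (d , 1≤d , ≢[]⇒length>0 nonEmpty , xd≡yd))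
  ... | inj₁ xd<yd = sym (cong (_∸ 1) (≤-antisym (proj₂ (inter d)) xd<yd))

take-suc-nth : ∀ {A : Set} (xs : List A) k {x} → nth xs k ≡ just x → take (suc k) xs ≡ take k xs ++ [ x ]
take-suc-nth (y ∷ xs) zero    refl = refl
take-suc-nth (y ∷ xs) (suc k) e    = cong (y ∷_) (take-suc-nth xs k e)

nth⇒<length : ∀ {A : Set} (xs : List A) {k x} → nth xs k ≡ just x → k < length xs
nth⇒<length (y ∷ xs) {zero}  e = s≤s z≤n
nth⇒<length (y ∷ xs) {suc k} e = s≤s (nth⇒<length xs e)

<length⇒nth : ∀ {A : Set} (xs : List A) {k} → k < length xs → ∃[ x ] (nth xs k ≡ just x)
<length⇒nth (y ∷ xs) {zero}  _          = y , refl
<length⇒nth (y ∷ xs) {suc k} (s≤s k<n) = <length⇒nth xs k<n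

nth-last : ∀ {A : Set} (xs : List A) {j} → j < length xs →
  ∃[ k ] ∃[ x ] (suc k ≡ length xs × j ≤ k × nth xs k ≡ just x)
nth-last (x ∷ [])     {zero}  _ = 0 , x , refl , z≤n , refl
nth-last (x ∷ [])     {suc j} (s≤s ())
nth-last (x ∷ y ∷ xs) {zero}  _ with nth-last (y ∷ xs) {0} (s≤s z≤n)
... | k , z , k+1≡n , _ , e = suc k , z , cong suc k+1≡n , z≤n , e
nth-last (x ∷ y ∷ xs) {suc j} (s≤s j<n) with nth-last (y ∷ xs) j<n
... | k , z , k+1≡n , j≤k , e = suc k , z , cong suc k+1≡n , s≤s j≤k , e

nth-take : ∀ {A : Set} (xs : List A) i {k x} → nth (take i xs) k ≡ just x → nth xs k ≡ just x
nth-take (y ∷ xs) (suc i) {zero}  e = e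
nth-take (y ∷ xs) (suc i) {suc k} e = nth-take xs i e

nth-All : ∀ {A : Set} {P : A → Set} (xs : List A) {k x} → nth xs k ≡ just x → All P xs → P x
nth-All (y ∷ xs) {zero}  refl (py ∷ _)  = py
nth-All (y ∷ xs) {suc k} e    (_ ∷ pxs) = nth-All xs e pxs

stepwise : ∀ {P : ℕ → Set} {B} → (∀ k → k < B → P k → P (suc k)) → ∀ {k j} → k ≤ j → j ≤ B → P k → P j
stepwise step {j = zero}  z≤n     _   pk = pk
stepwise step {j = suc j} k≤j+1 j<B pk with m≤n⇒m<n∨m≡n k≤j+1
... | inj₂ refl = pk
... | inj₁ k<j+1 = step j j<B (stepwise step (≤-pred k<j+1) (<⇒≤ j<B) pk)

CascStep⇒rightEndpoint-≥ : ∀ {I J} → CascStep I J → proj₂ J ≤ proj₂ I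
CascStep⇒rightEndpoint-≥ (inj₁ m'<m)       = <⇒≤ m'<m
CascStep⇒rightEndpoint-≥ (inj₂ (m'≡m , _)) = ≤-reflexive m'≡m

Linked-rightEndpoint-antitone : ∀ (xs : List Interval) → Linked CascStep xs →
  ∀ {j k I J} → nth xs j ≡ just I → nth xs k ≡ just J → j ≤ k → proj₂ J ≤ proj₂ I
Linked-rightEndpoint-antitone (x ∷ xs)     _          {zero}  {zero}  refl refl _ = ≤-refl
Linked-rightEndpoint-antitone (x ∷ [])     _          {_}     {suc k} _    ()   _
Linked-rightEndpoint-antitone (x ∷ y ∷ ys) (x~y ∷ lk) {zero}  {suc k} refl eJ   _ =
  ≤-trans (Linked-rightEndpoint-antitone (y ∷ ys) lk {0} {k} refl eJ z≤n) (CascStep⇒rightEndpoint-≥ x~y)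
Linked-rightEndpoint-antitone (x ∷ y ∷ ys) (_ ∷ lk)   {suc j} {suc k} eI   eJ   (s≤s j≤k) =
  Linked-rightEndpoint-antitone (y ∷ ys) lk eI eJ j≤k

lanesFrom-snoc : ∀ B b L (xs : List Interval) I →
  lanesFrom B b L (xs ++ [ I ]) ≡ processInterval B (lanesFrom B b L xs) (b + length xs) I
lanesFrom-snoc B b L []       I = cong (λ b' → processInterval B L b' I) (sym (+-identityʳ b))
lanesFrom-snoc B b L (x ∷ xs) I =
  trans (lanesFrom-snoc B (suc b) (processInterval B L b x) xs I)
        (cong (λ b' → processInterval B (lanesFrom B (suc b) (processInterval B L b x) xs) b' I) (sym (+-suc b (length xs))))

topLane-boundIrrelevant : ∀ B B' L a b → EmptyAbove b L → b ≤ B → b ≤ B' → topLane B L a ≡ topLane B' L a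
topLane-boundIrrelevant B B' L a b empty b≤B b≤B' =
  trans (findDown-stable p b B b≤B emptyAbove-b) (sym (findDown-stable p b B' b≤B' emptyAbove-b))
  where
    p = λ d → not (null (L a d))
    emptyAbove-b : ∀ {N} j → b < j → j ≤ N → p j ≡ false
    emptyAbove-b j b<j _ rewrite empty a j b<j = refl

-- The bound passed to processInterval only caps the search for a top lane, so any large enough one will do.
lanesFrom-boundIrrelevant : ∀ B B' b L (xs : List Interval) → EmptyAbove b L →
  b + length xs ≤ B → b + length xs ≤ B' → lanesFrom B b L xs ≡ lanesFrom B' b L xs
lanesFrom-boundIrrelevant B B' b L []            empty _ _ = refl
lanesFrom-boundIrrelevant B B' b L ((a , m) ∷ xs) empty b+n≤B b+n≤B'
  rewrite topLane-boundIrrelevant B B' L a b empty (≤-trans (m≤m+n b _) b+n≤B) (≤-trans (m≤m+n b _) b+n≤B') =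
  lanesFrom-boundIrrelevant B B' (suc b) (processInterval B' L b (a , m)) xs (EmptyAbove-processInterval B' L b a m empty)
    (≤-trans (≤-reflexive (sym (+-suc b (length xs)))) b+n≤B)
    (≤-trans (≤-reflexive (sym (+-suc b (length xs)))) b+n≤B')

module Prefixes (w n : ℕ) (α : List Interval) (casc : Cascading n α) (plat : Plateau (suc w) α) where
  open TwoValues w

  B : ℕ
  B = length α

  prefixLanes : ℕ → Lanes
  prefixLanes k = lanesFrom B 0 emptyLanes (take k α)

  prefixLanes-suc : ∀ {k I} → nth α k ≡ just I → prefixLanes (suc k) ≡ processInterval B (prefixLanes k) k I
  prefixLanes-suc {k} {I} e =
    trans (cong (lanesFrom B 0 emptyLanes) (take-suc-nth α k e))
      (trans (lanesFrom-snoc B 0 emptyLanes (take k α) I)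
        (cong (λ b → processInterval B (prefixLanes k) b I)
          (trans (length-take k α) (m≤n⇒m⊓n≡m (<⇒≤ (nth⇒<length α e))))))

  lanes≡prefixLanes : lanes α ≡ prefixLanes B
  lanes≡prefixLanes = cong (lanesFrom B 0 emptyLanes) (sym (take-all B α ≤-refl))

  lanes-take : ∀ {i} → i ≤ B → lanes (take i α) ≡ prefixLanes i
  lanes-take {i} _ =
    lanesFrom-boundIrrelevant (length (take i α)) B 0 emptyLanes (take i α) (λ _ _ _ → refl) ≤-refl
      (≤-trans (≤-reflexive (length-take i α)) (m⊓n≤n i B))

  lastInterval-endsAtRight : ∀ {k a m} → suc k ≡ B → nth α k ≡ just (a , m) → a ≤ m → ∃[ d ] EndsAtRight α m (suc d)
  lastInterval-endsAtRight {k} {a} {m} k+1≡B e a≤m with processInterval-rightEndpoint B (prefixLanes k) k a m a≤m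
  ... | d , lastEq = d , k , a , trans (cong (λ L → last (L m (suc d))) lanes≡last) lastEq , e
    where
      lanes≡last : lanes α ≡ processInterval B (prefixLanes k) k (a , m)
      lanes≡last = trans lanes≡prefixLanes (trans (cong prefixLanes (sym k+1≡B)) (prefixLanes-suc e))

  lastRightEndpoint-exceeds : ∀ {k a m} → suc k ≡ B → nth α k ≡ just (a , m) → w < m
  lastRightEndpoint-exceeds {k} {a} {m} k+1≡B e with nth-All α e (proj₁ casc)
  ... | 1≤a , a≤m , _ with lastInterval-endsAtRight k+1≡B e a≤m | <-cmp m w
  ...   | d , ends | tri< m<w _ _ = ⊥-elim (proj₂ (proj₂ plat) m (≤-trans 1≤a a≤m) m<w (suc d) (s≤s z≤n) ends)
  ...   | d , ends | tri≈ _ refl _ = ⊥-elim (proj₁ (proj₂ plat) (suc d) (s≤s z≤n) ends)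
  ...   | _        | tri> _ _ w<m = w<m

  rightEndpoint-exceeds : ∀ {j a m} → nth α j ≡ just (a , m) → w < m
  rightEndpoint-exceeds e with nth-last α (nth⇒<length α e)
  ... | k , _ , k+1≡B , j≤k , eLast =
    <-≤-trans (lastRightEndpoint-exceeds k+1≡B eLast) (Linked-rightEndpoint-antitone α (proj₂ casc) e eLast j≤k)

  Invariant : ℕ → Set
  Invariant k = EmptyAbove k (prefixLanes k) × Balanced (prefixLanes k)

  prefix-step : ∀ {k a m} → nth α k ≡ just (a , m) → Invariant k →
    Invariant (suc k) × (TiedLanes (prefixLanes k) → TiedLanes (prefixLanes (suc k)))
    × (a ≤ w → ¬ TiedLanes (prefixLanes k) → SharedLane k (prefixLanes (suc k)))
  prefix-step {k} {a} {m} e (empty , bal) =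
    subst Step (sym (prefixLanes-suc e))
      ((EmptyAbove-processInterval B (prefixLanes k) k a m empty , proj₁ step) , proj₂ step)
    where
      step = processInterval-balanced B (prefixLanes k) k a m empty (nth⇒<length α e) (rightEndpoint-exceeds e) bal
      Step : Lanes → Set
      Step L = (EmptyAbove (suc k) L × Balanced L) × (TiedLanes (prefixLanes k) → TiedLanes L)
        × (a ≤ w → ¬ TiedLanes (prefixLanes k) → SharedLane k L)

  prefix-invariant : ∀ k → k ≤ B → Invariant k
  prefix-invariant zero    _   = (λ _ _ _ → refl) , (λ _ → z≤n , z≤n) , (λ _ → z≤n)
  prefix-invariant (suc k) k<B with <length⇒nth α k<B
  ... | _ , e = proj₁ (prefix-step e (prefix-invariant k (<⇒≤ k<B)))

  prefix-untied : ∀ {k} → k ≤ B → ¬ TiedLanes (prefixLanes k)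
  prefix-untied k≤B tied =
    plateauLanes⇒untied (prefixLanes B) (subst PlateauLanes lanes≡prefixLanes (proj₁ plat))
      (stepwise {P = λ k → TiedLanes (prefixLanes k)} tie-step k≤B ≤-refl tied)
    where
      tie-step : ∀ k → k < B → TiedLanes (prefixLanes k) → TiedLanes (prefixLanes (suc k))
      tie-step k k<B with <length⇒nth α k<B
      ... | _ , e = proj₁ (proj₂ (prefix-step e (prefix-invariant k (<⇒≤ k<B))))

  ∈-prefixLanes-mono : ∀ {x v d k j} → k ≤ j → j ≤ B → x ∈ prefixLanes k v d → x ∈ prefixLanes j v d
  ∈-prefixLanes-mono {x} {v} {d} = stepwise {P = λ k → x ∈ prefixLanes k v d} ∈-step
    where
      ∈-step : ∀ k → k < B → x ∈ prefixLanes k v d → x ∈ prefixLanes (suc k) v d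
      ∈-step k k<B x∈ with <length⇒nth α k<B
      ... | (a , m) , e = subst (λ L → x ∈ L v d) (sym (prefixLanes-suc e)) (∈-processInterval⁺ B (prefixLanes k) k a m v d x∈)

  prefix-plateau : ∀ i → i ≤ B → Plateau (suc w) (take i α)
  prefix-plateau i i≤B =
    subst PlateauLanes (sym (lanes-take i≤B))
      (untied⇒plateauLanes (prefixLanes i) (proj₁ (proj₂ (prefix-invariant i i≤B))) (prefix-untied i≤B)) ,
    (λ { d _ (_ , _ , _ , e) → <-irrefl refl (rightEndpoint-exceeds (nth-take α i e)) }) ,
    (λ { k _ k<w d _ (_ , _ , _ , e) → <-asym k<w (rightEndpoint-exceeds (nth-take α i e)) })

  prefix-sharedLane : ∀ i → i ≤ B → ∀ b a m → b < i → nth α b ≡ just (a , m) → a ≤ w →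
    SharedLane b (lanes (take i α))
  prefix-sharedLane i i≤B b a m b<i e a≤w
    with proj₂ (proj₂ (prefix-step e (prefix-invariant b b≤B))) a≤w (prefix-untied b≤B)
    where
      b≤B = ≤-trans (<⇒≤ b<i) i≤B
  ... | d , inLow , inHigh = d , later inLow , later inHigh
    where
      later : ∀ {v} → b ∈ prefixLanes (suc b) v d → b ∈ lanes (take i α) v d
      later x∈ = subst (λ L → b ∈ L _ d) (sym (lanes-take i≤B)) (∈-prefixLanes-mono b<i i≤B x∈)

mainTheorem11 : (l n : ℕ) (α : List Interval) → 2 ≤ l → l ≤ n →
    Cascading n α → Plateau l α →
    (i : ℕ) → i ≤ length α →
      Plateau l (take i α)
      × (∀ b a m → b < i → nth α b ≡ just (a , m) → a ≤ l ∸ 1 → l ≤ m →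
           ∃[ d ] (b ∈ lanes (take i α) (l ∸ 1) d × b ∈ lanes (take i α) l d))
mainTheorem11 (suc (suc k)) n α (s≤s (s≤s z≤n)) _ casc plat i i≤B =
  prefix-plateau i i≤B , λ b a m b<i e a≤l-1 _ → prefix-sharedLane i i≤B b a m b<i e a≤l-1
  where
    open Prefixes (suc k) n α casc plat
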